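{- Let $a,b,n$ be positive integers. (i) If $1\le a<b\le n-1$, then $H_{n,b}$ does not have all $[a,b]$-factors. (ii) If $1\le a<b\le n-2$, then $H_{n,b}$ does not have all fractional $[a,b]$-factors.
   Context: For graphs $G_1,G_2$, the join $G_1\nabla G_2$ is obtained from the disjoint union $G_1\cup G_2$ by adding all edges between $V(G_1)$ and $V(G_2)$. For integers $2\le b\le n-1$, $H_{n,b}:=K_{b-1}\nabla(K_1\cup K_{n-b})$. For $h:V(G)\to\mathbb{Z}^+$, an $h$-factor of $G$ is a spanning subgraph $F$ with $d_F(v)=h(v)$ for all $v$. $G$ has all $[a,b]$-factors if it has an $h$-factor for every $h:V(G)\to\mathbb{Z}^+$ with $a\le h(v)\le b$ for all $v$ and $\sum_v h(v)\equiv 0\pmod 2$. For $p:V(G)\to\mathbb{Z}^+$, a fractional $p$-factor is given by a function $h:E(G)\to[0,1]$ with $\sum_{e\ni v}h(e)=p(v)$ for every vertex $v$. $G$ has all fractional $[a,b]$-factors if it has a fractional $p$-factor for every $p:V(G)\to\mathbb{Z}^+$ with $a\le p(v)\le b$ for all $v$.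
   Formalization: The weights of a fractional p-factor take values in the rationals of [0,1] instead of the real interval [0,1]. -}

module Defs where

open import Data.Nat using (ℕ; _+_; _∸_; _≤_)
open import Data.Nat.Divisibility using (_∣_)
open import Data.Fin using (Fin; splitAt)
open import Data.Fin.Properties using (_≟_)
open import Data.Bool using (Bool; true; false; not; if_then_else_)
open import Data.Sum using (inj₁; inj₂)
open import Data.List using (List; allFin; foldr; map)
open import Data.Product using (Σ; _×_; ∃)
open import Data.Rational as ℚ using (ℚ; 0ℚ; 1ℚ)
open import Data.Integer using (+_)
open import Relation.Nullary.Decidable using (⌊_⌋)
open import Relation.Binary.PropositionalEquality using (_≡_)

Graph : ℕ → Set
Graph m = Fin m → Fin m → Bool

K : (m : ℕ) → Graph m
K m i j = not ⌊ i ≟ j ⌋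

_∪G_ : {m k : ℕ} → Graph m → Graph k → Graph (m + k)
_∪G_ {m} G₁ G₂ i j with splitAt m i | splitAt m j
... | inj₁ x | inj₁ y = G₁ x y
... | inj₂ x | inj₂ y = G₂ x y
... | inj₁ _ | inj₂ _ = false
... | inj₂ _ | inj₁ _ = false

_∇_ : {m k : ℕ} → Graph m → Graph k → Graph (m + k)
_∇_ {m} G₁ G₂ i j with splitAt m i | splitAt m j
... | inj₁ x | inj₁ y = G₁ x y
... | inj₂ x | inj₂ y = G₂ x y
... | inj₁ _ | inj₂ _ = true
... | inj₂ _ | inj₁ _ = true

-- H_{n,b} = K_{b-1} ∇ (K_1 ∪ K_{n-b})  (has (b-1)+(1+(n-b)) = n vertices when 1 ≤ b ≤ n)
H : (n b : ℕ) → Graph ((b ∸ 1) + (1 + (n ∸ b)))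
H n b = K (b ∸ 1) ∇ (K 1 ∪G K (n ∸ b))

Σℕ : {m : ℕ} → (Fin m → ℕ) → ℕ
Σℕ {m} f = foldr _+_ 0 (map f (allFin m))

Σℚ : {m : ℕ} → (Fin m → ℚ) → ℚ
Σℚ {m} f = foldr ℚ._+_ 0ℚ (map f (allFin m))

deg : {m : ℕ} → Graph m → Fin m → ℕ
deg F v = Σℕ (λ u → if F v u then 1 else 0)

IsSpanningSubgraph : {m : ℕ} → Graph m → Graph m → Set
IsSpanningSubgraph {m} F G =
  ((u v : Fin m) → F u v ≡ F v u) ×
  ((u v : Fin m) → F u v ≡ true → G u v ≡ true)

HasFactor : {m : ℕ} → Graph m → (Fin m → ℕ) → Set
HasFactor G h = Σ _ λ F → IsSpanningSubgraph F G × (∀ v → deg F v ≡ h v)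

HasAllFactors : {m : ℕ} → Graph m → ℕ → ℕ → Set
HasAllFactors {m} G a b =
  (h : Fin m → ℕ) → (∀ v → a ≤ h v) → (∀ v → h v ≤ b) → 2 ∣ Σℕ h → HasFactor G h

-- Fractional p-factor: a weight function on the edges of G (represented as a
-- symmetric function on adjacent pairs) with values in [0,1] summing to p(v) at each v.
HasFractionalFactor : {m : ℕ} → Graph m → (Fin m → ℕ) → Set
HasFractionalFactor {m} G p = Σ (Fin m → Fin m → ℚ) λ w →
  ((u v : Fin m) → G u v ≡ true → w u v ≡ w v u) ×
  ((u v : Fin m) → G u v ≡ true → 0ℚ ℚ.≤ w u v) ×
  ((u v : Fin m) → G u v ≡ true → w u v ℚ.≤ 1ℚ) ×
  ((v : Fin m) → Σℚ (λ u → if G v u then w v u else 0ℚ) ≡ ((+ p v) ℚ./ 1))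

HasAllFractionalFactors : {m : ℕ} → Graph m → ℕ → ℕ → Set
HasAllFractionalFactors {m} G a b =
  (p : Fin m → ℕ) → (∀ v → a ≤ p v) → (∀ v → p v ≤ b) → HasFractionalFactor G p

-- The vertex u of K_1 in H_{n,b} is adjacent exactly to the b - 1 vertices
-- of K_{b-1}, so every spanning subgraph, and every edge weighting with
-- weights at most 1, gives u degree at most b - 1.  Hence no (fractional)
-- factor can demand b at u.  For ordinary factors the demand b at u is
-- completed to one with values in [a,b] and even sum by demanding b at every
-- other vertex, except b - 1 at a single one if the total would be odd.
module Submission where

open import Algebra.Bundles using (Monoid)
open import Data.Bool using (Bool; true; false; if_then_else_)
open import Data.Empty using (⊥)
open import Data.Fin using (Fin; zero; suc; _↑ˡ_; _↑ʳ_)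
open import Data.Fin.Properties using (splitAt-↑ˡ; splitAt-↑ʳ)
open import Data.Integer as ℤ using (+_)
import Data.Integer.Properties as ℤP
open import Data.List using (allFin; foldr; map)
open import Data.List.Properties using (map-tabulate)
open import Data.Nat using (ℕ; zero; suc; _+_; _*_; _∸_; _≤_; _<_; z≤n; s≤s)
open import Data.Nat.Coprimality using (1-coprimeTo) renaming (sym to coprime-sym)
open import Data.Nat.Divisibility using (_∣_; divides; ∣-refl; ∣m∣n⇒∣m+n)
import Data.Nat.Properties as ℕP
open import Data.Product using (_×_; _,_)
open import Data.Rational as ℚ using (ℚ; 0ℚ; 1ℚ; mkℚ)
import Data.Rational.Properties as ℚP
open import Data.Sum using (_⊎_; inj₁; inj₂; [_,_])
open import Function using (_∘_; id)
open import Level using (Level)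
open import Relation.Binary.Core using (Rel; _Preserves₂_⟶_⟶_)
open import Relation.Binary.PropositionalEquality
  using (_≡_; refl; sym; trans; cong; cong₂; subst; subst₂; module ≡-Reasoning)
open import Relation.Nullary using (¬_)

open import Defs

module FinSum {c ℓ : Level} (M : Monoid c ℓ) where
  open Monoid M using (Carrier; _≈_; _∙_; ε; setoid; identityˡ; assoc; ∙-congˡ)
    renaming (sym to ≈-sym)

  ∑ : {m : ℕ} → (Fin m → Carrier) → Carrier
  ∑ {m} f = foldr _∙_ ε (map f (allFin m))

  ∑-suc : {m : ℕ} (f : Fin (suc m) → Carrier) → ∑ f ≡ f zero ∙ ∑ (f ∘ suc)
  ∑-suc f = cong (λ xs → f zero ∙ foldr _∙_ ε xs)
    (trans (map-tabulate suc f) (sym (map-tabulate id (f ∘ suc))))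

  ∑-cong : {m : ℕ} {f g : Fin m → Carrier} → (∀ i → f i ≡ g i) → ∑ f ≡ ∑ g
  ∑-cong {zero} f≗g = refl
  ∑-cong {suc m} {f} {g} f≗g = begin
    ∑ f                  ≡⟨ ∑-suc f ⟩
    f zero ∙ ∑ (f ∘ suc) ≡⟨ cong₂ _∙_ (f≗g zero) (∑-cong (f≗g ∘ suc)) ⟩
    g zero ∙ ∑ (g ∘ suc) ≡⟨ ∑-suc g ⟨
    ∑ g                  ∎
    where open ≡-Reasoning

  ∑-↑ : (m k : ℕ) (f : Fin (m + k) → Carrier) →
        ∑ f ≈ ∑ (f ∘ (_↑ˡ k)) ∙ ∑ (f ∘ (m ↑ʳ_))
  ∑-↑ zero k f = ≈-sym (identityˡ _)
  ∑-↑ (suc m) k f = begin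
    ∑ f                                    ≡⟨ ∑-suc f ⟩
    f zero ∙ ∑ (f ∘ suc)                   ≈⟨ ∙-congˡ (∑-↑ m k (f ∘ suc)) ⟩
    f zero ∙ (∑ (f ∘ suc ∘ (_↑ˡ k)) ∙ R)   ≈⟨ assoc _ _ _ ⟨
    (f zero ∙ ∑ (f ∘ suc ∘ (_↑ˡ k))) ∙ R   ≡⟨ cong (_∙ R) (∑-suc (f ∘ (_↑ˡ k))) ⟨
    ∑ (f ∘ (_↑ˡ k)) ∙ R                    ∎
    where
    open import Relation.Binary.Reasoning.Setoid setoid
    R : Carrier
    R = ∑ (f ∘ suc ∘ (m ↑ʳ_))

  ∑-mono : {ℓ′ : Level} (_≤_ : Rel Carrier ℓ′) → ε ≤ ε → _∙_ Preserves₂ _≤_ ⟶ _≤_ ⟶ _≤_ →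
           {m : ℕ} {f g : Fin m → Carrier} → (∀ i → f i ≤ g i) → ∑ f ≤ ∑ g
  ∑-mono _≤_ ε≤ε ∙-mono {zero} f≤g = ε≤ε
  ∑-mono _≤_ ε≤ε ∙-mono {suc m} {f} {g} f≤g =
    subst₂ _≤_ (sym (∑-suc f)) (sym (∑-suc g))
      (∙-mono (f≤g zero) (∑-mono _≤_ ε≤ε ∙-mono {f = f ∘ suc} {g ∘ suc} (f≤g ∘ suc)))

open FinSum ℕP.+-0-monoid using () renaming (∑-suc to Σℕ-suc; ∑-cong to Σℕ-cong; ∑-↑ to Σℕ-↑)
open FinSum ℚP.+-0-monoid using () renaming (∑-suc to Σℚ-suc)

Σℕ-mono : {m : ℕ} {f g : Fin m → ℕ} → (∀ i → f i ≤ g i) → Σℕ f ≤ Σℕ g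
Σℕ-mono = FinSum.∑-mono ℕP.+-0-monoid _≤_ ℕP.≤-refl ℕP.+-mono-≤

Σℚ-mono : {m : ℕ} {f g : Fin m → ℚ} → (∀ i → f i ℚ.≤ g i) → Σℚ f ℚ.≤ Σℚ g
Σℚ-mono = FinSum.∑-mono ℚP.+-0-monoid ℚ._≤_ ℚP.≤-refl ℚP.+-mono-≤

Σℕ-const : (m c : ℕ) → Σℕ {m} (λ _ → c) ≡ m * c
Σℕ-const zero c = refl
Σℕ-const (suc m) c = trans (Σℕ-suc {m} (λ _ → c)) (cong (_+_ c) (Σℕ-const m c))

toℚ : ℕ → ℚ
toℚ m = + m ℚ./ 1

toℚ≡mkℚ : (m : ℕ) → toℚ m ≡ mkℚ (+ m) 0 (coprime-sym (1-coprimeTo m))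
toℚ≡mkℚ m = ℚP.normalize-coprime (coprime-sym (1-coprimeTo m))

toℚ-homo-+ : (m n : ℕ) → toℚ (m + n) ≡ toℚ m ℚ.+ toℚ n
toℚ-homo-+ m n = sym (begin
  toℚ m ℚ.+ toℚ n
    ≡⟨ cong₂ ℚ._+_ (toℚ≡mkℚ m) (toℚ≡mkℚ n) ⟩
  (+ m ℤ.* + 1 ℤ.+ + n ℤ.* + 1) ℚ./ 1
    ≡⟨ ℚP./-cong (cong₂ ℤ._+_ (ℤP.*-identityʳ (+ m)) (ℤP.*-identityʳ (+ n))) refl ⟩
  toℚ (m + n) ∎)
  where open ≡-Reasoning

toℚ-cancel-≤ : {m n : ℕ} → toℚ m ℚ.≤ toℚ n → m ≤ n
toℚ-cancel-≤ {m} {n} m≤n = ℤP.drop‿+≤+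
  (subst₂ ℤ._≤_ (ℤP.*-identityʳ (+ m)) (ℤP.*-identityʳ (+ n))
    (ℚP.drop-*≤* (subst₂ ℚ._≤_ (toℚ≡mkℚ m) (toℚ≡mkℚ n) m≤n)))

Σℚ-toℚ : {m : ℕ} (f : Fin m → ℕ) → Σℚ (toℚ ∘ f) ≡ toℚ (Σℕ f)
Σℚ-toℚ {zero} f = refl
Σℚ-toℚ {suc m} f = begin
  Σℚ (toℚ ∘ f)                        ≡⟨ Σℚ-suc (toℚ ∘ f) ⟩
  toℚ (f zero) ℚ.+ Σℚ (toℚ ∘ f ∘ suc) ≡⟨ cong (toℚ (f zero) ℚ.+_) (Σℚ-toℚ (f ∘ suc)) ⟩
  toℚ (f zero) ℚ.+ toℚ (Σℕ (f ∘ suc)) ≡⟨ toℚ-homo-+ (f zero) _ ⟨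
  toℚ (f zero + Σℕ (f ∘ suc))         ≡⟨ cong toℚ (Σℕ-suc f) ⟨
  toℚ (Σℕ f)                          ∎
  where open ≡-Reasoning

deg-mono : {m : ℕ} {F G : Graph m} → IsSpanningSubgraph F G → (v : Fin m) → deg F v ≤ deg G v
deg-mono {F = F} {G} (_ , F⊆G) v = Σℕ-mono edge≤
  where
  edge≤ : ∀ u → (if F v u then 1 else 0) ≤ (if G v u then 1 else 0)
  edge≤ u with F v u in vu∈F
  ... | false = z≤n
  ... | true rewrite F⊆G v u vu∈F = ℕP.≤-refl

factor-≤-deg : {m : ℕ} {G : Graph m} {h : Fin m → ℕ} → HasFactor G h → (v : Fin m) → h v ≤ deg G v
factor-≤-deg {G = G} (F , F⊆G , degF) v = subst (_≤ deg G v) (degF v) (deg-mono F⊆G v)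

weightedDegree-≤-deg : {m : ℕ} (G : Graph m) (w : Fin m → Fin m → ℚ) (v : Fin m) →
  (∀ u → G v u ≡ true → w v u ℚ.≤ 1ℚ) →
  Σℚ (λ u → if G v u then w v u else 0ℚ) ℚ.≤ toℚ (deg G v)
weightedDegree-≤-deg G w v w≤1 =
  subst (Σℚ (λ u → if G v u then w v u else 0ℚ) ℚ.≤_)
    (Σℚ-toℚ (λ u → if G v u then 1 else 0)) (Σℚ-mono edge≤)
  where
  edge≤ : ∀ u → (if G v u then w v u else 0ℚ) ℚ.≤ toℚ (if G v u then 1 else 0)
  edge≤ u with G v u in vu∈G
  ... | true = w≤1 u vu∈G
  ... | false = ℚP.≤-refl

fractionalFactor-≤-deg : {m : ℕ} {G : Graph m} {p : Fin m → ℕ} →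
  HasFractionalFactor G p → (v : Fin m) → p v ≤ deg G v
fractionalFactor-≤-deg {G = G} (w , _ , _ , w≤1 , sums) v =
  toℚ-cancel-≤ (subst (ℚ._≤ toℚ (deg G v)) (sums v) (weightedDegree-≤-deg G w v (w≤1 v)))

2∣n⊎2∣1+n : (n : ℕ) → 2 ∣ n ⊎ 2 ∣ suc n
2∣n⊎2∣1+n zero = inj₁ (divides 0 refl)
2∣n⊎2∣1+n (suc n) with 2∣n⊎2∣1+n n
... | inj₁ 2∣n = inj₂ (∣m∣n⇒∣m+n ∣-refl 2∣n)
... | inj₂ 2∣1+n = inj₁ 2∣1+n

lowDegree⇒¬HasAllFactors : {m a b : ℕ} {G : Graph (suc m)} (v : Fin m) →
  deg G (suc v) < b → a < b → ¬ HasAllFactors G a b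
lowDegree⇒¬HasAllFactors {m} {a} {suc c} {G} v deg<b (s≤s a≤c) all =
  [ refute c a≤c (ℕP.n≤1+n c) , refute (suc c) (ℕP.m≤n⇒m≤1+n a≤c) ℕP.≤-refl ]
    (2∣n⊎2∣1+n (c + Σℕ {m} (λ _ → suc c)))
  where
  demand : ℕ → Fin (suc m) → ℕ
  demand d zero = d
  demand d (suc _) = suc c
  refute : (d : ℕ) → a ≤ d → d ≤ suc c → 2 ∣ d + Σℕ {m} (λ _ → suc c) → ⊥
  refute d a≤d d≤b even = ℕP.<⇒≱ deg<b (factor-≤-deg factor (suc v))
    where
    lower : ∀ u → a ≤ demand d u
    lower zero = a≤d
    lower (suc _) = ℕP.m≤n⇒m≤1+n a≤c
    upper : ∀ u → demand d u ≤ suc c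
    upper zero = d≤b
    upper (suc _) = ℕP.≤-refl
    factor : HasFactor G (demand d)
    factor = all (demand d) lower upper (subst (2 ∣_) (sym (Σℕ-suc (demand d))) even)

lowDegree⇒¬HasAllFractionalFactors : {m a b : ℕ} {G : Graph m} (v : Fin m) →
  deg G v < b → a ≤ b → ¬ HasAllFractionalFactors G a b
lowDegree⇒¬HasAllFractionalFactors {b = b} v deg<b a≤b all =
  ℕP.<⇒≱ deg<b (fractionalFactor-≤-deg (all (λ _ → b) (λ _ → a≤b) (λ _ → ℕP.≤-refl)) v)

∇-↑ʳ-↑ˡ : {m k : ℕ} (G₁ : Graph m) (G₂ : Graph k) (y : Fin k) (x : Fin m) →
  (G₁ ∇ G₂) (m ↑ʳ y) (x ↑ˡ k) ≡ true
∇-↑ʳ-↑ˡ {m} {k} G₁ G₂ y x rewrite splitAt-↑ʳ m k y | splitAt-↑ˡ m x k = refl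

∇-↑ʳ-↑ʳ : {m k : ℕ} (G₁ : Graph m) (G₂ : Graph k) (y z : Fin k) →
  (G₁ ∇ G₂) (m ↑ʳ y) (m ↑ʳ z) ≡ G₂ y z
∇-↑ʳ-↑ʳ {m} {k} G₁ G₂ y z rewrite splitAt-↑ʳ m k y | splitAt-↑ʳ m k z = refl

deg-∇-↑ʳ : {m k : ℕ} (G₁ : Graph m) (G₂ : Graph k) (y : Fin k) →
  deg (G₁ ∇ G₂) (m ↑ʳ y) ≡ m + deg G₂ y
deg-∇-↑ʳ {m} {k} G₁ G₂ y = begin
  deg (G₁ ∇ G₂) (m ↑ʳ y)
    ≡⟨ Σℕ-↑ m k _ ⟩
  Σℕ (indicator ∘ (G₁ ∇ G₂) (m ↑ʳ y) ∘ (_↑ˡ k)) +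
  Σℕ (indicator ∘ (G₁ ∇ G₂) (m ↑ʳ y) ∘ (m ↑ʳ_))
    ≡⟨ cong₂ _+_ (Σℕ-cong (cong indicator ∘ ∇-↑ʳ-↑ˡ G₁ G₂ y))
                 (Σℕ-cong (cong indicator ∘ ∇-↑ʳ-↑ʳ G₁ G₂ y)) ⟩
  Σℕ {m} (λ _ → 1) + deg G₂ y
    ≡⟨ cong (_+ deg G₂ y) (trans (Σℕ-const m 1) (ℕP.*-identityʳ m)) ⟩
  m + deg G₂ y ∎
  where
  open ≡-Reasoning
  indicator : Bool → ℕ
  indicator e = if e then 1 else 0

deg-K₁∪G-zero : {k : ℕ} (G : Graph k) → deg (K 1 ∪G G) zero ≡ 0
deg-K₁∪G-zero {k} G = trans (Σℕ-cong no-edge) (trans (Σℕ-const (suc k) 0) (ℕP.*-zeroʳ k))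
  where
  no-edge : ∀ y → (if (K 1 ∪G G) zero y then 1 else 0) ≡ 0
  no-edge zero = refl
  no-edge (suc _) = refl

isolated : (n b : ℕ) → Fin ((b ∸ 1) + (1 + (n ∸ b)))
isolated n b = (b ∸ 1) ↑ʳ zero

deg-H-isolated : (n b : ℕ) → deg (H n b) (isolated n b) ≡ b ∸ 1
deg-H-isolated n b = begin
  deg (H n b) (isolated n b)          ≡⟨ deg-∇-↑ʳ (K (b ∸ 1)) (K 1 ∪G K (n ∸ b)) zero ⟩
  b ∸ 1 + deg (K 1 ∪G K (n ∸ b)) zero ≡⟨ cong (_+_ (b ∸ 1)) (deg-K₁∪G-zero (K (n ∸ b))) ⟩
  b ∸ 1 + 0                           ≡⟨ ℕP.+-identityʳ (b ∸ 1) ⟩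
  b ∸ 1                               ∎
  where open ≡-Reasoning

deg-H-isolated<b : (n c : ℕ) → deg (H n (suc c)) (isolated n (suc c)) < suc c
deg-H-isolated<b n c = ℕP.≤-reflexive (cong suc (deg-H-isolated n (suc c)))

H-¬HasAllFactors : {a b n : ℕ} → 1 ≤ a → a < b → ¬ HasAllFactors (H n b) a b
H-¬HasAllFactors {b = suc zero} (s≤s _) (s≤s ())
H-¬HasAllFactors {b = suc (suc k)} {n} _ a<b =
  lowDegree⇒¬HasAllFactors (k ↑ʳ zero) (deg-H-isolated<b n (suc k)) a<b

H-¬HasAllFractionalFactors : {a b n : ℕ} → 1 ≤ b → a ≤ b → ¬ HasAllFractionalFactors (H n b) a b
H-¬HasAllFractionalFactors {b = suc c} {n} _ =
  lowDegree⇒¬HasAllFractionalFactors (isolated n (suc c)) (deg-H-isolated<b n c)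

lemma2p4 : (a b n : ℕ) → 1 ≤ a → 1 ≤ b → 1 ≤ n →
    ((a < b → b ≤ n ∸ 1 → ¬ HasAllFactors (H n b) a b) ×
     (a < b → b ≤ n ∸ 2 → ¬ HasAllFractionalFactors (H n b) a b))
lemma2p4 a b n 1≤a 1≤b _ =
  (λ a<b _ → H-¬HasAllFactors 1≤a a<b) ,
  (λ a<b _ → H-¬HasAllFractionalFactors 1≤b (ℕP.<⇒≤ a<b))
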